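{- For all integers $n\geq m\geq 0$, \[ B_{n,m}(q):=\frac{[2n]!\,[m]!}{[n]!\,[2m]!\,[n-m]!} \] is a polynomial in $q$ with non-negative integer coefficients.
   Context: For a non-negative integer $n$, the $q$-factorial is $[n]!=[n]_q!=\prod_{i=1}^n \frac{1-q^i}{1-q}$ (so $[0]!=1$). A polynomial is called positive if all its coefficients are non-negative. -}

module Defs where

open import Data.Nat using (ℕ; zero; suc; _+_; _*_)
open import Data.List using (List; []; _∷_; replicate)
open import Relation.Binary.PropositionalEquality using (_≡_)

-- Polynomials in q with natural-number coefficients, as coefficient lists,
-- lowest degree first: a₀ ∷ a₁ ∷ … represents a₀ + a₁ q + …
Poly : Set
Poly = List ℕ

coeff : Poly → ℕ → ℕ
coeff []       _       = 0
coeff (a ∷ p)  zero    = a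
coeff (a ∷ p)  (suc k) = coeff p k

-- equality of polynomials: all coefficients agree (ignores trailing zeros)
infix 4 _≈ₚ_
_≈ₚ_ : Poly → Poly → Set
p ≈ₚ r = ∀ k → coeff p k ≡ coeff r k

infixl 6 _+ₚ_
_+ₚ_ : Poly → Poly → Poly
[]      +ₚ r       = r
(a ∷ p) +ₚ []      = a ∷ p
(a ∷ p) +ₚ (b ∷ r) = (a + b) ∷ (p +ₚ r)

_·ₚ_ : ℕ → Poly → Poly
c ·ₚ []      = []
c ·ₚ (a ∷ p) = (c * a) ∷ (c ·ₚ p)

infixl 7 _*ₚ_
_*ₚ_ : Poly → Poly → Poly
[]      *ₚ r = []
(a ∷ p) *ₚ r = (a ·ₚ r) +ₚ (0 ∷ (p *ₚ r))

oneₚ : Poly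
oneₚ = 1 ∷ []

-- q-integer [i]_q = (1 - q^i)/(1 - q) = 1 + q + … + q^(i-1)
qInt : ℕ → Poly
qInt i = replicate i 1

qFact : ℕ → Poly
qFact zero    = oneₚ
qFact (suc n) = qFact n *ₚ qInt (suc n)

-- Writing n = m + k, the quotient is built by induction on (m, k) from the
-- Pascal-type recurrence (for m, k ≥ 1, n = m + k)
--   B(n,m) = q^k · B(n-1,m-1) + b(m,k) · B(n-1,m),
--   b(m,k) = 1 + q^(k+2m-1) + q^(k+3m-1) + q^(2k+3m-1),
-- with boundary values B(n,n) = 1 and B(n,0) = [2n]!/([n]![n]!), the central
-- q-binomial coefficient, which is itself a polynomial by the q-Pascal rule.
module Submission where

open import Defs
open import Data.Nat using (ℕ; zero; suc; _+_; _*_; _≤_; _∸_)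
import Data.Nat.Properties as ℕ
open import Data.List using ([]; _∷_)
open import Data.Product using (∃; _,_)
open import Relation.Binary.PropositionalEquality
  using (_≡_; refl; sym; trans; cong; cong₂; subst)
open import Data.Nat.Tactic.RingSolver using (solve-∀)
open import Algebra.Bundles using (CommutativeSemiring; CommutativeMonoid)
import Algebra.Properties.CommutativeSemigroup as CommutativeSemigroupProperties

-- Coefficientwise equality, wrapped in a record so that the two polynomials
-- can be inferred from an equality proof (the bare Π-type of _≈ₚ_ hides them).
infix 4 _≋_
record _≋_ (p r : Poly) : Set where
  constructor coeffwise
  field coeff-≡ : p ≈ₚ r
open _≋_

≋-refl : ∀ {p} → p ≋ p
≋-refl = coeffwise λ _ → refl

≋-sym : ∀ {p r} → p ≋ r → r ≋ p
≋-sym (coeffwise h) = coeffwise λ k → sym (h k)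

≋-trans : ∀ {p r s} → p ≋ r → r ≋ s → p ≋ s
≋-trans (coeffwise h) (coeffwise g) = coeffwise λ k → trans (h k) (g k)

≡⇒≋ : ∀ {p r} → p ≡ r → p ≋ r
≡⇒≋ refl = ≋-refl

coeff-+ₚ : ∀ p r k → coeff (p +ₚ r) k ≡ coeff p k + coeff r k
coeff-+ₚ []      r       k       = refl
coeff-+ₚ (a ∷ p) []      k       = sym (ℕ.+-identityʳ _)
coeff-+ₚ (a ∷ p) (b ∷ r) zero    = refl
coeff-+ₚ (a ∷ p) (b ∷ r) (suc k) = coeff-+ₚ p r k

coeff-·ₚ : ∀ c p k → coeff (c ·ₚ p) k ≡ c * coeff p k
coeff-·ₚ c []      k       = sym (ℕ.*-zeroʳ c)
coeff-·ₚ c (a ∷ p) zero    = refl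
coeff-·ₚ c (a ∷ p) (suc k) = coeff-·ₚ c p k

[]≋0∷[] : [] ≋ (0 ∷ [])
[]≋0∷[] = coeffwise λ { zero → refl ; (suc k) → refl }

∷-cong : ∀ {a b p r} → a ≡ b → p ≋ r → (a ∷ p) ≋ (b ∷ r)
∷-cong a≡b (coeffwise h) = coeffwise λ { zero → a≡b ; (suc k) → h k }

pointwise : ∀ {p r} (f g : ℕ → ℕ) → (∀ k → coeff p k ≡ f k) → (∀ k → f k ≡ g k) →
            (∀ k → coeff r k ≡ g k) → p ≋ r
pointwise f g p≡f f≡g r≡g = coeffwise λ k → trans (p≡f k) (trans (f≡g k) (sym (r≡g k)))

+ₚ-cong : ∀ {p p′ r r′} → p ≋ p′ → r ≋ r′ → (p +ₚ r) ≋ (p′ +ₚ r′)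
+ₚ-cong {p} {p′} {r} {r′} (coeffwise h) (coeffwise g) =
  pointwise _ _ (coeff-+ₚ p r) (λ k → cong₂ _+_ (h k) (g k)) (coeff-+ₚ p′ r′)

+ₚ-comm : ∀ p r → (p +ₚ r) ≋ (r +ₚ p)
+ₚ-comm p r = pointwise _ _ (coeff-+ₚ p r) (λ k → ℕ.+-comm (coeff p k) _) (coeff-+ₚ r p)

+ₚ-assoc : ∀ p r s → ((p +ₚ r) +ₚ s) ≋ (p +ₚ (r +ₚ s))
+ₚ-assoc p r s = pointwise _ _
  (λ k → trans (coeff-+ₚ (p +ₚ r) s k) (cong (_+ coeff s k) (coeff-+ₚ p r k)))
  (λ k → ℕ.+-assoc (coeff p k) _ _)
  (λ k → trans (coeff-+ₚ p (r +ₚ s) k) (cong (coeff p k +_) (coeff-+ₚ r s k)))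

+ₚ-identityʳ : ∀ p → (p +ₚ []) ≋ p
+ₚ-identityʳ p = coeffwise λ k → trans (coeff-+ₚ p [] k) (ℕ.+-identityʳ _)

-- Addition makes polynomials a commutative monoid; the rearrangement lemmas
-- of commutative semigroups are needed for the distributive laws below.
+ₚ-commutativeMonoid : CommutativeMonoid _ _
+ₚ-commutativeMonoid = record
  { Carrier = Poly ; _≈_ = _≋_ ; _∙_ = _+ₚ_ ; ε = []
  ; isCommutativeMonoid = record
    { isMonoid = record
      { isSemigroup = record
        { isMagma = record
          { isEquivalence = record { refl = ≋-refl ; sym = ≋-sym ; trans = ≋-trans }
          ; ∙-cong = +ₚ-cong }
        ; assoc = +ₚ-assoc }
      ; identity = (λ _ → ≋-refl) , +ₚ-identityʳ }
    ; comm = +ₚ-comm } }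

open CommutativeSemigroupProperties (CommutativeMonoid.commutativeSemigroup +ₚ-commutativeMonoid)
  using (interchange; x∙yz≈y∙xz)

·ₚ-cong : ∀ {c d p r} → c ≡ d → p ≋ r → (c ·ₚ p) ≋ (d ·ₚ r)
·ₚ-cong {c} {d} {p} {r} c≡d (coeffwise h) =
  pointwise _ _ (coeff-·ₚ c p) (λ k → cong₂ _*_ c≡d (h k)) (coeff-·ₚ d r)

·ₚ-distribˡ : ∀ c p r → (c ·ₚ (p +ₚ r)) ≋ ((c ·ₚ p) +ₚ (c ·ₚ r))
·ₚ-distribˡ c p r = pointwise _ _
  (λ k → trans (coeff-·ₚ c (p +ₚ r) k) (cong (c *_) (coeff-+ₚ p r k)))
  (λ k → ℕ.*-distribˡ-+ c (coeff p k) _)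
  (λ k → trans (coeff-+ₚ (c ·ₚ p) _ k) (cong₂ _+_ (coeff-·ₚ c p k) (coeff-·ₚ c r k)))

·ₚ-distribʳ : ∀ c d p → ((c + d) ·ₚ p) ≋ ((c ·ₚ p) +ₚ (d ·ₚ p))
·ₚ-distribʳ c d p = pointwise _ _
  (coeff-·ₚ (c + d) p)
  (λ k → ℕ.*-distribʳ-+ (coeff p k) c d)
  (λ k → trans (coeff-+ₚ (c ·ₚ p) _ k) (cong₂ _+_ (coeff-·ₚ c p k) (coeff-·ₚ d p k)))

·ₚ-assoc : ∀ c d p → (c ·ₚ (d ·ₚ p)) ≋ ((c * d) ·ₚ p)
·ₚ-assoc c d p = pointwise _ _
  (λ k → trans (coeff-·ₚ c (d ·ₚ p) k) (cong (c *_) (coeff-·ₚ d p k)))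
  (λ k → sym (ℕ.*-assoc c d _))
  (coeff-·ₚ (c * d) p)

0·ₚ : ∀ p → (0 ·ₚ p) ≋ []
0·ₚ p = coeffwise (coeff-·ₚ 0 p)

1·ₚ : ∀ p → (1 ·ₚ p) ≋ p
1·ₚ p = coeffwise λ k → trans (coeff-·ₚ 1 p k) (ℕ.+-identityʳ _)

-- Multiplying by a polynomial all of whose coefficients vanish gives zero;
-- needed because such a polynomial need not be the empty list.
*ₚ-zeroˡ′ : ∀ {p} → p ≋ [] → ∀ r → (p *ₚ r) ≋ []
*ₚ-zeroˡ′ {[]}    _             r = ≋-refl
*ₚ-zeroˡ′ {a ∷ p} (coeffwise h) r =
  ≋-trans (+ₚ-cong (≋-trans (·ₚ-cong (h 0) ≋-refl) (0·ₚ r))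
                   (∷-cong refl (*ₚ-zeroˡ′ {p} (coeffwise λ k → h (suc k)) r)))
          (≋-sym []≋0∷[])

*ₚ-congˡ : ∀ {p p′} r → p ≋ p′ → (p *ₚ r) ≋ (p′ *ₚ r)
*ₚ-congˡ {[]}    {[]}      r _ = ≋-refl
*ₚ-congˡ {[]}    {a ∷ p′}  r h = ≋-sym (*ₚ-zeroˡ′ (≋-sym h) r)
*ₚ-congˡ {a ∷ p} {[]}      r h = *ₚ-zeroˡ′ h r
*ₚ-congˡ {a ∷ p} {a′ ∷ p′} r (coeffwise h) =
  +ₚ-cong (·ₚ-cong (h 0) ≋-refl) (∷-cong refl (*ₚ-congˡ {p} {p′} r (coeffwise λ k → h (suc k))))

*ₚ-congʳ : ∀ p {r r′} → r ≋ r′ → (p *ₚ r) ≋ (p *ₚ r′)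
*ₚ-congʳ []      _ = ≋-refl
*ₚ-congʳ (a ∷ p) h = +ₚ-cong (·ₚ-cong refl h) (∷-cong refl (*ₚ-congʳ p h))

*ₚ-cong : ∀ {p p′ r r′} → p ≋ p′ → r ≋ r′ → (p *ₚ r) ≋ (p′ *ₚ r′)
*ₚ-cong {p′ = p′} {r = r} h g = ≋-trans (*ₚ-congˡ r h) (*ₚ-congʳ p′ g)

0∷-*ₚ : ∀ p r → ((0 ∷ p) *ₚ r) ≋ (0 ∷ (p *ₚ r))
0∷-*ₚ p r = +ₚ-cong (0·ₚ r) ≋-refl

·ₚ-*ₚ : ∀ c p r → ((c ·ₚ p) *ₚ r) ≋ (c ·ₚ (p *ₚ r))
·ₚ-*ₚ c []      r = ≋-refl
·ₚ-*ₚ c (a ∷ p) r =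
  ≋-trans (+ₚ-cong (≋-sym (·ₚ-assoc c a r)) (∷-cong (sym (ℕ.*-zeroʳ c)) (·ₚ-*ₚ c p r)))
          (≋-sym (·ₚ-distribˡ c (a ·ₚ r) (0 ∷ (p *ₚ r))))

*ₚ-distribʳ : ∀ s p r → ((p +ₚ r) *ₚ s) ≋ ((p *ₚ s) +ₚ (r *ₚ s))
*ₚ-distribʳ s []      r       = ≋-refl
*ₚ-distribʳ s (a ∷ p) []      = ≋-sym (+ₚ-identityʳ _)
*ₚ-distribʳ s (a ∷ p) (b ∷ r) =
  ≋-trans (+ₚ-cong (·ₚ-distribʳ a b s) (∷-cong refl (*ₚ-distribʳ s p r)))
          (interchange (a ·ₚ s) (b ·ₚ s) (0 ∷ (p *ₚ s)) (0 ∷ (r *ₚ s)))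

*ₚ-distribˡ : ∀ p r s → (p *ₚ (r +ₚ s)) ≋ ((p *ₚ r) +ₚ (p *ₚ s))
*ₚ-distribˡ []      r s = ≋-refl
*ₚ-distribˡ (a ∷ p) r s =
  ≋-trans (+ₚ-cong (·ₚ-distribˡ a r s) (∷-cong refl (*ₚ-distribˡ p r s)))
          (interchange (a ·ₚ r) (a ·ₚ s) (0 ∷ (p *ₚ r)) (0 ∷ (p *ₚ s)))

*ₚ-zeroʳ : ∀ p → (p *ₚ []) ≋ []
*ₚ-zeroʳ []      = ≋-refl
*ₚ-zeroʳ (a ∷ p) = ≋-trans (∷-cong refl (*ₚ-zeroʳ p)) (≋-sym []≋0∷[])

*ₚ-∷ʳ : ∀ p b r → (p *ₚ (b ∷ r)) ≋ ((b ·ₚ p) +ₚ (0 ∷ (p *ₚ r)))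
*ₚ-∷ʳ []      b r = []≋0∷[]
*ₚ-∷ʳ (a ∷ p) b r =
  ∷-cong (cong (_+ 0) (ℕ.*-comm a b))
    (≋-trans (+ₚ-cong (≋-refl {a ·ₚ r}) (*ₚ-∷ʳ p b r)) (x∙yz≈y∙xz (a ·ₚ r) (b ·ₚ p) (0 ∷ (p *ₚ r))))

*ₚ-comm : ∀ p r → (p *ₚ r) ≋ (r *ₚ p)
*ₚ-comm []      r = ≋-sym (*ₚ-zeroʳ r)
*ₚ-comm (a ∷ p) r =
  ≋-trans (+ₚ-cong (≋-refl {a ·ₚ r}) (∷-cong refl (*ₚ-comm p r))) (≋-sym (*ₚ-∷ʳ r a p))

*ₚ-assoc : ∀ p r s → ((p *ₚ r) *ₚ s) ≋ (p *ₚ (r *ₚ s))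
*ₚ-assoc []      r s = ≋-refl
*ₚ-assoc (a ∷ p) r s =
  ≋-trans (*ₚ-distribʳ s (a ·ₚ r) (0 ∷ (p *ₚ r)))
          (+ₚ-cong (·ₚ-*ₚ a r s) (≋-trans (0∷-*ₚ (p *ₚ r) s) (∷-cong refl (*ₚ-assoc p r s))))

*ₚ-identityˡ : ∀ p → (oneₚ *ₚ p) ≋ p
*ₚ-identityˡ p = ≋-trans (+ₚ-cong (1·ₚ p) (≋-sym []≋0∷[])) (+ₚ-identityʳ p)

polySemiring : CommutativeSemiring _ _
polySemiring = record
  { isCommutativeSemiring = record
    { isSemiring = record
      { isSemiringWithoutAnnihilatingZero = record
        { +-isCommutativeMonoid = CommutativeMonoid.isCommutativeMonoid +ₚ-commutativeMonoid
        ; *-cong = *ₚ-cong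
        ; *-assoc = *ₚ-assoc
        ; *-identity = *ₚ-identityˡ , (λ p → ≋-trans (*ₚ-comm p oneₚ) (*ₚ-identityˡ p))
        ; distrib = *ₚ-distribˡ , *ₚ-distribʳ }
      ; zero = (λ _ → ≋-refl) , *ₚ-zeroʳ }
    ; *-comm = *ₚ-comm } }

open import Algebra.Solver.Ring.NaturalCoefficients.Default polySemiring
open import Relation.Binary.Reasoning.Setoid (CommutativeSemiring.setoid polySemiring)
open CommutativeSemiring polySemiring using () renaming (*-identityʳ to *ₚ-identityʳ)

qPow : ℕ → Poly
qPow zero    = oneₚ
qPow (suc a) = 0 ∷ qPow a

qPow-+ : ∀ a b → qPow (a + b) ≋ (qPow a *ₚ qPow b)
qPow-+ zero    b = ≋-sym (*ₚ-identityˡ (qPow b))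
qPow-+ (suc a) b = ≋-trans (∷-cong refl (qPow-+ a b)) (≋-sym (0∷-*ₚ (qPow a) (qPow b)))

qInt-+ : ∀ a b → qInt (a + b) ≋ (qInt a +ₚ qPow a *ₚ qInt b)
qInt-+ zero    b = ≋-sym (*ₚ-identityˡ (qInt b))
qInt-+ (suc a) b =
  ≋-trans (∷-cong refl (qInt-+ a b))
          (≋-sym (+ₚ-cong (≋-refl {qInt (suc a)}) (0∷-*ₚ (qPow a) (qInt b))))

-- [2a] = [a] (1 + q^a), for a = x + 1 in the form in which 2a unfolds.
qInt-double : ∀ x → qInt (suc (suc (2 * x))) ≋ (qInt (suc x) *ₚ (oneₚ +ₚ qPow (suc x)))
qInt-double x = begin
  qInt (suc (suc (2 * x)))                   ≈⟨ ≡⇒≋ (cong qInt (2+2x≡[1+x]+[1+x] x)) ⟩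
  qInt (suc x + suc x)                       ≈⟨ qInt-+ (suc x) (suc x) ⟩
  qInt (suc x) +ₚ qPow (suc x) *ₚ qInt (suc x)
    ≈⟨ solve 2 (λ I Q → I :+ Q :* I := I :* (con 1 :+ Q)) ≋-refl (qInt (suc x)) (qPow (suc x)) ⟩
  qInt (suc x) *ₚ (oneₚ +ₚ qPow (suc x))     ∎
  where
  2+2x≡[1+x]+[1+x] : ∀ x → suc (suc (2 * x)) ≡ suc x + suc x
  2+2x≡[1+x]+[1+x] = solve-∀

qFact-double-suc : ∀ x →
  qFact (2 * suc x) ≋ (qFact (2 * x) *ₚ qInt (suc (2 * x)) *ₚ qInt (suc (suc (2 * x))))
qFact-double-suc x = ≡⇒≋ (cong qFact (ℕ.*-suc 2 x))

infix 4 _∣ₚ_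
_∣ₚ_ : Poly → Poly → Set
d ∣ₚ p = ∃ λ B → (B *ₚ d) ≋ p

≋⇒∣ₚ : ∀ {d p} → d ≋ p → d ∣ₚ p
≋⇒∣ₚ {d} d≋p = oneₚ , ≋-trans (*ₚ-identityˡ d) d≋p

∣ₚ-resp : ∀ {d d′ p p′} → d ≋ d′ → p ≋ p′ → d ∣ₚ p → d′ ∣ₚ p′
∣ₚ-resp {d} d≋d′ p≋p′ (B , Bd≋p) = B , ≋-trans (*ₚ-cong (≋-refl {B}) (≋-sym d≋d′)) (≋-trans Bd≋p p≋p′)

-- Pascal-type recurrences preserve integrality: if D = D₁u₁ = D₂u₂ where
-- D₁ ∣ N₁ and D₂ ∣ N₂ = N₁w, then D divides N₁ (c₁u₁ + c₂wu₂), with quotient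
-- c₁ (N₁/D₁) + c₂ (N₂/D₂).
∣ₚ-pascal : ∀ {D₁ N₁ D₂ N₂ D N} c₁ c₂ u₁ u₂ w →
  D₁ ∣ₚ N₁ → D₂ ∣ₚ N₂ → (D₁ *ₚ u₁) ≋ D → (D₂ *ₚ u₂) ≋ D → (N₁ *ₚ w) ≋ N₂ →
  (N₁ *ₚ (c₁ *ₚ u₁ +ₚ c₂ *ₚ (w *ₚ u₂))) ≋ N → D ∣ₚ N
∣ₚ-pascal {D₁} {N₁} {D₂} {N₂} {D} {N} c₁ c₂ u₁ u₂ w
          (B₁ , B₁D₁≋N₁) (B₂ , B₂D₂≋N₂) D₁u₁≋D D₂u₂≋D N₁w≋N₂ value =
  c₁ *ₚ B₁ +ₚ c₂ *ₚ B₂ , (begin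
    (c₁ *ₚ B₁ +ₚ c₂ *ₚ B₂) *ₚ D
      ≈⟨ solve 5 (λ c₁ B₁ c₂ B₂ D → (c₁ :* B₁ :+ c₂ :* B₂) :* D := c₁ :* B₁ :* D :+ c₂ :* B₂ :* D)
               ≋-refl c₁ B₁ c₂ B₂ D ⟩
    c₁ *ₚ B₁ *ₚ D +ₚ c₂ *ₚ B₂ *ₚ D
      ≈⟨ +ₚ-cong (*ₚ-cong (≋-refl {c₁ *ₚ B₁}) (≋-sym D₁u₁≋D)) (*ₚ-cong (≋-refl {c₂ *ₚ B₂}) (≋-sym D₂u₂≋D)) ⟩
    c₁ *ₚ B₁ *ₚ (D₁ *ₚ u₁) +ₚ c₂ *ₚ B₂ *ₚ (D₂ *ₚ u₂)
      ≈⟨ solve 8 (λ c₁ B₁ D₁ u₁ c₂ B₂ D₂ u₂ →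
                  c₁ :* B₁ :* (D₁ :* u₁) :+ c₂ :* B₂ :* (D₂ :* u₂)
                  := c₁ :* (B₁ :* D₁) :* u₁ :+ c₂ :* (B₂ :* D₂) :* u₂)
               ≋-refl c₁ B₁ D₁ u₁ c₂ B₂ D₂ u₂ ⟩
    c₁ *ₚ (B₁ *ₚ D₁) *ₚ u₁ +ₚ c₂ *ₚ (B₂ *ₚ D₂) *ₚ u₂
      ≈⟨ +ₚ-cong (*ₚ-cong (*ₚ-cong (≋-refl {c₁}) B₁D₁≋N₁) (≋-refl {u₁}))
                 (*ₚ-cong (*ₚ-cong (≋-refl {c₂}) (≋-trans B₂D₂≋N₂ (≋-sym N₁w≋N₂))) (≋-refl {u₂})) ⟩
    c₁ *ₚ N₁ *ₚ u₁ +ₚ c₂ *ₚ (N₁ *ₚ w) *ₚ u₂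
      ≈⟨ solve 6 (λ c₁ N₁ u₁ c₂ w u₂ →
                  c₁ :* N₁ :* u₁ :+ c₂ :* (N₁ :* w) :* u₂ := N₁ :* (c₁ :* u₁ :+ c₂ :* (w :* u₂)))
               ≋-refl c₁ N₁ u₁ c₂ w u₂ ⟩
    N₁ *ₚ (c₁ *ₚ u₁ +ₚ c₂ *ₚ (w *ₚ u₂))
      ≈⟨ value ⟩
    N ∎)

-- q-binomial coefficients are polynomials: [a]! [b]! divides [a+b]!.  The
-- step is q-Pascal, [a+b+2] = 1·[a+1] + q^(a+1)·[b+1].
qBinomial : ∀ a b → qFact a *ₚ qFact b ∣ₚ qFact (a + b)
qBinomial zero    b       = ≋⇒∣ₚ (*ₚ-identityˡ (qFact b))
qBinomial (suc a) zero    =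
  ≋⇒∣ₚ (≋-trans (*ₚ-identityʳ (qFact (suc a))) (≡⇒≋ (cong qFact (sym (ℕ.+-identityʳ (suc a))))))
qBinomial (suc a) (suc b) =
  ∣ₚ-pascal oneₚ (qPow (suc a)) Ia Ib oneₚ
    (qBinomial a (suc b)) (qBinomial (suc a) b)
    (solve 4 (λ Fa Fb Ia Ib → Fa :* (Fb :* Ib) :* Ia := Fa :* Ia :* (Fb :* Ib)) ≋-refl Fa Fb Ia Ib)
    (*ₚ-assoc (qFact (suc a)) Fb Ib)
    (≋-trans (*ₚ-identityʳ (qFact (a + suc b))) (≡⇒≋ (cong qFact (ℕ.+-suc a b))))
    (*ₚ-cong (≋-refl {qFact (a + suc b)}) qPascal)
  where
  Fa = qFact a
  Fb = qFact b
  Ia = qInt (suc a)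
  Ib = qInt (suc b)
  qPascal : (oneₚ *ₚ Ia +ₚ qPow (suc a) *ₚ (oneₚ *ₚ Ib)) ≋ qInt (suc a + suc b)
  qPascal = ≋-trans (+ₚ-cong (*ₚ-identityˡ Ia) (*ₚ-cong (≋-refl {qPow (suc a)}) (*ₚ-identityˡ Ib)))
                    (≋-sym (qInt-+ (suc a) (suc b)))

-- The coefficient b(m,k) = 1 + q^(k+2m-1) + q^(k+3m-1) + q^(2k+3m-1) of the
-- recurrence for B, written for m = j + 1.
pascalWeight : ℕ → ℕ → Poly
pascalWeight j k = oneₚ +ₚ Qk *ₚ Q2m-1 +ₚ Qk *ₚ Q2m-1 *ₚ Qm +ₚ Qk *ₚ Q2m-1 *ₚ Qm *ₚ Qk
  where
  Qk = qPow k
  Qm = qPow (suc j)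
  Q2m-1 = qPow (suc (2 * j))

-- Both sides are compared after splitting 2n-1 = k + (2m-1) + k
-- and using [2m-1] + q^(2m-1) [k] = [k] + q^k [2m-1] (= [2m-1+k]).
weightedSplit : ∀ j k →
  ((oneₚ +ₚ qPow (suc (j + k))) *ₚ qInt (suc (2 * (j + k))))
    ≋ (qPow k *ₚ (oneₚ +ₚ qPow (suc j)) *ₚ qInt (suc (2 * j)) +ₚ pascalWeight j k *ₚ qInt k)
weightedSplit j k = begin
  (oneₚ +ₚ qPow (suc (j + k))) *ₚ qInt (suc (2 * (j + k)))
    ≈⟨ *ₚ-cong (+ₚ-cong (≋-refl {oneₚ}) qPow-n) qInt-2n-1 ⟩
  (oneₚ +ₚ Qk *ₚ Qm) *ₚ (Ik +ₚ Qk *ₚ (I2m-1 +ₚ Q2m-1 *ₚ Ik))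
    ≈⟨ solve 5 (λ Qk Qm Q2m-1 I2m-1 Ik →
         (con 1 :+ Qk :* Qm) :* (Ik :+ Qk :* (I2m-1 :+ Q2m-1 :* Ik))
         := (Ik :+ Qk :* I2m-1 :+ Qk :* Q2m-1 :* Ik :+ Qk :* Qm :* Qk :* Q2m-1 :* Ik)
            :+ Qk :* Qm :* (Ik :+ Qk :* I2m-1))
       ≋-refl Qk Qm Q2m-1 I2m-1 Ik ⟩
  Common +ₚ Qk *ₚ Qm *ₚ (Ik +ₚ Qk *ₚ I2m-1)
    ≈⟨ +ₚ-cong (≋-refl {Common}) (*ₚ-cong (≋-refl {Qk *ₚ Qm}) commuteSplit) ⟩
  Common +ₚ Qk *ₚ Qm *ₚ (I2m-1 +ₚ Q2m-1 *ₚ Ik)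
    ≈⟨ solve 5 (λ Qk Qm Q2m-1 I2m-1 Ik →
         (Ik :+ Qk :* I2m-1 :+ Qk :* Q2m-1 :* Ik :+ Qk :* Qm :* Qk :* Q2m-1 :* Ik)
           :+ Qk :* Qm :* (I2m-1 :+ Q2m-1 :* Ik)
         := Qk :* (con 1 :+ Qm) :* I2m-1
            :+ (con 1 :+ Qk :* Q2m-1 :+ Qk :* Q2m-1 :* Qm :+ Qk :* Q2m-1 :* Qm :* Qk) :* Ik)
       ≋-refl Qk Qm Q2m-1 I2m-1 Ik ⟩
  Qk *ₚ (oneₚ +ₚ Qm) *ₚ I2m-1 +ₚ pascalWeight j k *ₚ Ik ∎
  where
  Qk = qPow k
  Qm = qPow (suc j)
  Q2m-1 = qPow (suc (2 * j))
  I2m-1 = qInt (suc (2 * j))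
  Ik = qInt k
  Common : Poly
  Common = Ik +ₚ Qk *ₚ I2m-1 +ₚ Qk *ₚ Q2m-1 *ₚ Ik +ₚ Qk *ₚ Qm *ₚ Qk *ₚ Q2m-1 *ₚ Ik
  n≡k+m : ∀ j k → suc (j + k) ≡ k + suc j
  n≡k+m = solve-∀
  2n-1≡k+[2m-1]+k : ∀ j k → suc (2 * (j + k)) ≡ k + (suc (2 * j) + k)
  2n-1≡k+[2m-1]+k = solve-∀
  qPow-n : qPow (suc (j + k)) ≋ (Qk *ₚ Qm)
  qPow-n = ≋-trans (≡⇒≋ (cong qPow (n≡k+m j k))) (qPow-+ k (suc j))
  qInt-2n-1 : qInt (suc (2 * (j + k))) ≋ (Ik +ₚ Qk *ₚ (I2m-1 +ₚ Q2m-1 *ₚ Ik))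
  qInt-2n-1 = ≋-trans (≡⇒≋ (cong qInt (2n-1≡k+[2m-1]+k j k)))
                (≋-trans (qInt-+ k (suc (2 * j) + k))
                  (+ₚ-cong (≋-refl {Ik}) (*ₚ-cong (≋-refl {Qk}) (qInt-+ (suc (2 * j)) k))))
  commuteSplit : (Ik +ₚ Qk *ₚ I2m-1) ≋ (I2m-1 +ₚ Q2m-1 *ₚ Ik)
  commuteSplit = ≋-trans (≋-sym (qInt-+ k (suc (2 * j))))
                   (≋-trans (≡⇒≋ (cong qInt (ℕ.+-comm k (suc (2 * j))))) (qInt-+ (suc (2 * j)) k))

-- q^k [n] [2m-1] [2m] + b(m,k) [m] [n] [k] = [2n-1] [2n] [m]  for m = j + 1,
-- n = m + k: the identity behind the recurrence for B(n,m).  Both sides are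
-- [m] [n] times the two sides of weightedSplit, by [2a] = [a] (1 + q^a).
centralPascal : ∀ j k → let n = suc (j + k) in
  (qPow k *ₚ (qInt n *ₚ qInt (suc (2 * j)) *ₚ qInt (suc (suc (2 * j))))
     +ₚ pascalWeight j k *ₚ (qInt (suc j) *ₚ (qInt n *ₚ qInt k)))
    ≋ (qInt (suc (2 * (j + k))) *ₚ qInt (suc (suc (2 * (j + k)))) *ₚ qInt (suc j))
centralPascal j k = begin
  Qk *ₚ (In *ₚ I2m-1 *ₚ I2m) +ₚ b *ₚ (Im *ₚ (In *ₚ Ik))
    ≈⟨ +ₚ-cong (*ₚ-cong (≋-refl {Qk}) (*ₚ-cong (≋-refl {In *ₚ I2m-1}) (qInt-double j))) (≋-refl {b *ₚ (Im *ₚ (In *ₚ Ik))}) ⟩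
  Qk *ₚ (In *ₚ I2m-1 *ₚ (Im *ₚ (oneₚ +ₚ Qm))) +ₚ b *ₚ (Im *ₚ (In *ₚ Ik))
    ≈⟨ solve 7 (λ Qk In I2m-1 Im Qm b Ik →
         Qk :* (In :* I2m-1 :* (Im :* (con 1 :+ Qm))) :+ b :* (Im :* (In :* Ik))
         := Im :* In :* (Qk :* (con 1 :+ Qm) :* I2m-1 :+ b :* Ik))
       ≋-refl Qk In I2m-1 Im Qm b Ik ⟩
  Im *ₚ In *ₚ (Qk *ₚ (oneₚ +ₚ Qm) *ₚ I2m-1 +ₚ b *ₚ Ik)
    ≈⟨ *ₚ-cong (≋-refl {Im *ₚ In}) (≋-sym (weightedSplit j k)) ⟩
  Im *ₚ In *ₚ ((oneₚ +ₚ Qn) *ₚ I2n-1)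
    ≈⟨ solve 4 (λ Im In Qn I2n-1 → Im :* In :* ((con 1 :+ Qn) :* I2n-1) := I2n-1 :* (In :* (con 1 :+ Qn)) :* Im)
       ≋-refl Im In Qn I2n-1 ⟩
  I2n-1 *ₚ (In *ₚ (oneₚ +ₚ Qn)) *ₚ Im
    ≈⟨ *ₚ-cong (*ₚ-cong (≋-refl {I2n-1}) (≋-sym (qInt-double (j + k)))) (≋-refl {Im}) ⟩
  I2n-1 *ₚ qInt (suc (suc (2 * (j + k)))) *ₚ Im ∎
  where
  Qk = qPow k
  Qm = qPow (suc j)
  Qn = qPow (suc (j + k))
  Ik = qInt k
  Im = qInt (suc j)
  In = qInt (suc (j + k))
  I2m-1 = qInt (suc (2 * j))
  I2m = qInt (suc (suc (2 * j)))
  I2n-1 = qInt (suc (2 * (j + k)))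
  b = pascalWeight j k

centralDen : ℕ → ℕ → Poly
centralDen m k = qFact (m + k) *ₚ qFact (2 * m) *ₚ qFact k

centralNum : ℕ → ℕ → Poly
centralNum m k = qFact (2 * (m + k)) *ₚ qFact m

-- B(m+k, m) is a polynomial: for m = 0 it is the central q-binomial
-- coefficient, for k = 0 it is 1, and otherwise the recurrence
-- B(n,m) = q^k B(n-1,m-1) + b(m,k) B(n-1,m) applies.
centralQuotient : ∀ m k → centralDen m k ∣ₚ centralNum m k
centralQuotient zero    k       =
  ∣ₚ-resp (*ₚ-cong (≋-sym (*ₚ-identityʳ (qFact k))) (≋-refl {qFact k}))
          (≋-trans (≡⇒≋ (cong (λ i → qFact (k + i)) (sym (ℕ.+-identityʳ k)))) (≋-sym (*ₚ-identityʳ _)))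
          (qBinomial k k)
centralQuotient (suc j) zero    =
  subst (λ n → centralDen′ n ∣ₚ qFact (2 * n) *ₚ qFact (suc j)) (sym (ℕ.+-identityʳ (suc j)))
        (≋⇒∣ₚ (≋-trans (*ₚ-identityʳ _) (*ₚ-comm (qFact (suc j)) (qFact (2 * suc j)))))
  where
  centralDen′ : ℕ → Poly
  centralDen′ n = qFact n *ₚ qFact (2 * suc j) *ₚ oneₚ
centralQuotient (suc j) (suc k) =
  ∣ₚ-pascal (qPow (suc k)) (pascalWeight j (suc k)) (In *ₚ I2m-1 *ₚ I2m) (In *ₚ Ik) Im
    (centralQuotient j (suc k)) previousRow
    (begin
      FM *ₚ F2j *ₚ Fk *ₚ (In *ₚ I2m-1 *ₚ I2m)
        ≈⟨ solve 6 (λ FM F2j Fk In I2m-1 I2m →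
             FM :* F2j :* Fk :* (In :* I2m-1 :* I2m) := FM :* In :* (F2j :* I2m-1 :* I2m) :* Fk)
           ≋-refl FM F2j Fk In I2m-1 I2m ⟩
      FM *ₚ In *ₚ (F2j *ₚ I2m-1 *ₚ I2m) *ₚ Fk
        ≈⟨ *ₚ-cong (*ₚ-cong (≋-refl {FM *ₚ In}) (≋-sym (qFact-double-suc j))) (≋-refl {Fk}) ⟩
      centralDen (suc j) (suc k) ∎)
    (solve 5 (λ FM F2m Fk In Ik → FM :* F2m :* Fk :* (In :* Ik) := FM :* In :* F2m :* (Fk :* Ik))
       ≋-refl FM (qFact (2 * suc j)) (qFact k) In Ik)
    (*ₚ-assoc (qFact (2 * M)) (qFact j) Im)
    (begin
      qFact (2 * M) *ₚ qFact j *ₚ _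
        ≈⟨ *ₚ-cong (≋-refl {qFact (2 * M) *ₚ qFact j}) (centralPascal j (suc k)) ⟩
      qFact (2 * M) *ₚ qFact j *ₚ (I2n-1 *ₚ I2n *ₚ Im)
        ≈⟨ solve 5 (λ F2M Fj I2n-1 I2n Im → F2M :* Fj :* (I2n-1 :* I2n :* Im) := F2M :* I2n-1 :* I2n :* (Fj :* Im))
           ≋-refl (qFact (2 * M)) (qFact j) I2n-1 I2n Im ⟩
      qFact (2 * M) *ₚ I2n-1 *ₚ I2n *ₚ qFact (suc j)
        ≈⟨ *ₚ-cong (≋-sym (qFact-double-suc M)) (≋-refl {qFact (suc j)}) ⟩
      centralNum (suc j) (suc k) ∎)
  where
  M = j + suc k
  FM = qFact M
  F2j = qFact (2 * j)
  Fk = qFact (suc k)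
  Ik = qInt (suc k)
  Im = qInt (suc j)
  In = qInt (suc M)
  I2m-1 = qInt (suc (2 * j))
  I2m = qInt (suc (suc (2 * j)))
  I2n-1 = qInt (suc (2 * M))
  I2n = qInt (suc (suc (2 * M)))
  -- B(n-1, m), reindexed from (m + (k-1)) to n - 1 = j + (k+1)
  previousRow : qFact M *ₚ qFact (2 * suc j) *ₚ qFact k ∣ₚ qFact (2 * M) *ₚ qFact (suc j)
  previousRow = subst (λ i → qFact i *ₚ qFact (2 * suc j) *ₚ qFact k ∣ₚ qFact (2 * i) *ₚ qFact (suc j))
                      (sym (ℕ.+-suc j k)) (centralQuotient (suc j) k)

mainTheorem2 : ∀ n m → m ≤ n →
    ∃ λ (B : Poly) →
    B *ₚ (qFact n *ₚ qFact (2 * m) *ₚ qFact (n ∸ m)) ≈ₚ qFact (2 * n) *ₚ qFact m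
mainTheorem2 n m m≤n with subst (λ i → qFact i *ₚ qFact (2 * m) *ₚ qFact (n ∸ m) ∣ₚ qFact (2 * i) *ₚ qFact m)
                                 (ℕ.m+[n∸m]≡n m≤n) (centralQuotient m (n ∸ m))
... | B , B·den≋num = B , coeff-≡ B·den≋num
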